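{- Let $M\models T_{\mathrm{MSO(Fin)}}$ and let $\varphi(x)$ be an $\mathcal{L}$-formula in one free variable. Then \[M\models\big(\varphi(0)\wedge\forall x\forall y((\varphi(x)\wedge s(x)=y)\rightarrow\varphi(y))\big)\rightarrow\forall x\,\varphi(x).\]
   Context: Let $\mathcal{L}=\{\subseteq,\bot,\mathrm{At},\lhd\}$ be the first-order language with binary relation symbols $\subseteq,\lhd$, a constant $\bot$ and a unary relation symbol $\mathrm{At}$. Lowercase variables range over atoms; $X(x)$ abbreviates $x\subseteq X$. $T_{\mathrm{base}}$ states: $\subseteq$ is an atomic Boolean algebra order (one-element algebra allowed); $\lhd$ linearly orders the atoms; $\bot$ is least; $\mathrm{At}$ holds exactly of atoms; $\forall X\forall Y(X\lhd Y\leftrightarrow\exists x\exists y(X(x)\wedge Y(y)\wedge x\lhd y))$; and for every $\mathcal{L}$-formula $\eta(x;\bar Y)$, $\forall\bar Y\exists X\forall x(X(x)\leftrightarrow\eta(x;\bar Y))$. $T_{\mathrm{MSO(Fin)}}$ is $T_{\mathrm{base}}$ plus: the order on atoms is discrete with endpoints, and every $X\neq\bot$ contains a $\lhd$-least atom. In its models $0$ and $0^*$ denote the least and greatest atoms, and $s(x)=y$ abbreviates the definable relation "$x\lhd 0^*$ and $y$ is the immediate $\lhd$-successor of $x$". -}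

module Defs where

open import Data.Nat using (ℕ; suc; _≟_)
open import Data.Product using (_×_)
open import Data.Empty using (⊥)
open import Relation.Nullary using (¬_; yes; no)
open import Relation.Binary.PropositionalEquality using (_≡_; _≢_)

data Term : Set where
  v   : ℕ → Term
  bot : Term

infix  7 _⊑_ _◃_ _≐_
infixr 6 _∧_
infixr 5 _∨_
infixr 4 _⇒_ _⇔_

data Fm : Set where
  _⊑_ : Term → Term → Fm
  _◃_ : Term → Term → Fm
  _≐_ : Term → Term → Fm
  At  : Term → Fm
  ff  : Fm
  _⇒_ : Fm → Fm → Fm
  _∧_ : Fm → Fm → Fm
  ∀'  : ℕ → Fm → Fm

~_ : Fm → Fm
~ φ = φ ⇒ ff

_∨_ : Fm → Fm → Fm
φ ∨ ψ = ~ (~ φ ∧ ~ ψ)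

_⇔_ : Fm → Fm → Fm
φ ⇔ ψ = (φ ⇒ ψ) ∧ (ψ ⇒ φ)

∃' : ℕ → Fm → Fm
∃' x φ = ~ ∀' x (~ φ)

-- lowercase (atom) quantifiers: relativised to At
∀ᵃ : ℕ → Fm → Fm
∀ᵃ x φ = ∀' x (At (v x) ⇒ φ)

∃ᵃ : ℕ → Fm → Fm
∃ᵃ x φ = ∃' x (At (v x) ∧ φ)

FreeT : ℕ → Term → Set
FreeT x (v y) = x ≡ y
FreeT x bot   = ⊥

data Free (x : ℕ) : Fm → Set where
  f⊑ˡ : ∀ {t u} → FreeT x t → Free x (t ⊑ u)
  f⊑ʳ : ∀ {t u} → FreeT x u → Free x (t ⊑ u)
  f◃ˡ : ∀ {t u} → FreeT x t → Free x (t ◃ u)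
  f◃ʳ : ∀ {t u} → FreeT x u → Free x (t ◃ u)
  f≐ˡ : ∀ {t u} → FreeT x t → Free x (t ≐ u)
  f≐ʳ : ∀ {t u} → FreeT x u → Free x (t ≐ u)
  fAt : ∀ {t} → FreeT x t → Free x (At t)
  f⇒ˡ : ∀ {φ ψ} → Free x φ → Free x (φ ⇒ ψ)
  f⇒ʳ : ∀ {φ ψ} → Free x ψ → Free x (φ ⇒ ψ)
  f∧ˡ : ∀ {φ ψ} → Free x φ → Free x (φ ∧ ψ)
  f∧ʳ : ∀ {φ ψ} → Free x ψ → Free x (φ ∧ ψ)
  f∀  : ∀ {y φ} → x ≢ y → Free x φ → Free x (∀' y φ)

OnlyFree : ℕ → Fm → Set
OnlyFree x φ = ∀ y → Free y φ → y ≡ x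

-- Structures and (classical) satisfaction.
-- Satisfaction is the Goedel–Gentzen (double negation) reading, so that
-- it is the classical Tarskian satisfaction relation, constructively.

record Structure : Set₁ where
  field
    Carrier : Set
    _⊆ᴹ_    : Carrier → Carrier → Set
    _◁ᴹ_    : Carrier → Carrier → Set
    ⊥ᴹ      : Carrier
    Atᴹ     : Carrier → Set

module _ (M : Structure) where
  open Structure M

  Env : Set
  Env = ℕ → Carrier

  _[_≔_] : Env → ℕ → Carrier → Env
  (ρ [ x ≔ a ]) y with y ≟ x
  ... | yes _ = a
  ... | no  _ = ρ y

  evalT : Env → Term → Carrier
  evalT ρ (v x) = ρ x
  evalT ρ bot   = ⊥ᴹ

  ⟦_⟧ : Fm → Env → Set
  ⟦ t ⊑ u ⟧ ρ = ¬ ¬ (evalT ρ t ⊆ᴹ evalT ρ u)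
  ⟦ t ◃ u ⟧ ρ = ¬ ¬ (evalT ρ t ◁ᴹ evalT ρ u)
  ⟦ t ≐ u ⟧ ρ = ¬ ¬ (evalT ρ t ≡ evalT ρ u)
  ⟦ At t ⟧ ρ  = ¬ ¬ (Atᴹ (evalT ρ t))
  ⟦ ff ⟧ ρ    = ⊥
  ⟦ φ ⇒ ψ ⟧ ρ = ⟦ φ ⟧ ρ → ⟦ ψ ⟧ ρ
  ⟦ φ ∧ ψ ⟧ ρ = ⟦ φ ⟧ ρ × ⟦ ψ ⟧ ρ
  ⟦ ∀' x φ ⟧ ρ = (a : Carrier) → ⟦ φ ⟧ (ρ [ x ≔ a ])

  _⊨_ : Fm → Set
  _⊨_ φ = (ρ : Env) → ⟦ φ ⟧ ρ

-- m is the meet (greatest lower bound) of a and b; d is a bound helper name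
IsMeet : ℕ → ℕ → ℕ → ℕ → Fm
IsMeet a b m d = v m ⊑ v a ∧ v m ⊑ v b ∧
                 ∀' d ((v d ⊑ v a ∧ v d ⊑ v b) ⇒ v d ⊑ v m)

IsJoin : ℕ → ℕ → ℕ → ℕ → Fm
IsJoin a b j d = v a ⊑ v j ∧ v b ⊑ v j ∧
                 ∀' d ((v a ⊑ v d ∧ v b ⊑ v d) ⇒ v j ⊑ v d)

IsAtom : ℕ → ℕ → Fm
IsAtom t d = ~ (v t ≐ bot) ∧ ∀' d (v d ⊑ v t ⇒ (v d ≐ bot ∨ v d ≐ v t))

LeastAt : ℕ → ℕ → Fm
LeastAt x y = At (v x) ∧ ∀ᵃ y (v y ≐ v x ∨ v x ◃ v y)

GreatestAt : ℕ → ℕ → Fm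
GreatestAt x y = At (v x) ∧ ∀ᵃ y (v y ≐ v x ∨ v y ◃ v x)

data TBase : Fm → Set where
  -- ⊆ is an atomic Boolean algebra order (one-element algebra allowed)
  ⊆-refl    : TBase (∀' 0 (v 0 ⊑ v 0))
  ⊆-antisym : TBase (∀' 0 (∀' 1 ((v 0 ⊑ v 1 ∧ v 1 ⊑ v 0) ⇒ v 0 ≐ v 1)))
  ⊆-trans   : TBase (∀' 0 (∀' 1 (∀' 2 ((v 0 ⊑ v 1 ∧ v 1 ⊑ v 2) ⇒ v 0 ⊑ v 2))))
  ⊆-bottom  : TBase (∃' 0 (∀' 1 (v 0 ⊑ v 1)))
  ⊆-top     : TBase (∃' 0 (∀' 1 (v 1 ⊑ v 0)))
  ⊆-meet    : TBase (∀' 0 (∀' 1 (∃' 2 (IsMeet 0 1 2 20))))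
  ⊆-join    : TBase (∀' 0 (∀' 1 (∃' 2 (IsJoin 0 1 2 20))))
  ⊆-distrib : TBase (∀' 0 (∀' 1 (∀' 2 (∀' 3 (∀' 4 (∀' 5 (∀' 6 (∀' 7
                ((IsJoin 1 2 3 20 ∧ IsMeet 0 3 4 20 ∧ IsMeet 0 1 5 20 ∧
                  IsMeet 0 2 6 20 ∧ IsJoin 5 6 7 20)
                 ⇒ v 4 ⊑ v 7)))))))))
  ⊆-compl   : TBase (∀' 0 (∃' 1
                (∀' 2 ((v 2 ⊑ v 0 ∧ v 2 ⊑ v 1) ⇒ ∀' 3 (v 2 ⊑ v 3)) ∧
                 ∀' 2 ((v 0 ⊑ v 2 ∧ v 1 ⊑ v 2) ⇒ ∀' 3 (v 3 ⊑ v 2)))))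
  ⊆-atomic  : TBase (∀' 0 (~ (v 0 ≐ bot) ⇒ ∃' 1 (IsAtom 1 20 ∧ v 1 ⊑ v 0)))
  ⊥-least   : TBase (∀' 0 (bot ⊑ v 0))
  At-atom   : TBase (∀' 0 (At (v 0) ⇔ IsAtom 0 20))
  ◃-irrefl  : TBase (∀ᵃ 0 (~ (v 0 ◃ v 0)))
  ◃-trans   : TBase (∀ᵃ 0 (∀ᵃ 1 (∀ᵃ 2 ((v 0 ◃ v 1 ∧ v 1 ◃ v 2) ⇒ v 0 ◃ v 2))))
  ◃-total   : TBase (∀ᵃ 0 (∀ᵃ 1 (v 0 ◃ v 1 ∨ v 0 ≐ v 1 ∨ v 1 ◃ v 0)))
  ◃-ext     : TBase (∀' 0 (∀' 1 (v 0 ◃ v 1 ⇔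
                ∃ᵃ 2 (∃ᵃ 3 (v 2 ⊑ v 0 ∧ v 3 ⊑ v 1 ∧ v 2 ◃ v 3)))))
  -- comprehension: for every formula η(x; Ȳ),  ∀Ȳ ∃X ∀x (X(x) ↔ η)
  -- (the parameters Ȳ are the other free variables of η; satisfaction
  --  is universal closure, X must not occur free in η)
  compr     : (η : Fm) (x X : ℕ) → x ≢ X → ¬ Free X η →
              TBase (∃' X (∀ᵃ x (v x ⊑ v X ⇔ η)))

data TMSOFin : Fm → Set where
  base      : ∀ {σ} → TBase σ → TMSOFin σ
  least-ex  : TMSOFin (∀ᵃ 0 (∃' 1 (LeastAt 1 2)))
  great-ex  : TMSOFin (∀ᵃ 0 (∃' 1 (GreatestAt 1 2)))
  succ-ex   : TMSOFin (∀ᵃ 0 (~ (GreatestAt 0 9) ⇒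
                ∃ᵃ 1 (v 0 ◃ v 1 ∧ ~ (∃ᵃ 2 (v 0 ◃ v 2 ∧ v 2 ◃ v 1)))))
  pred-ex   : TMSOFin (∀ᵃ 0 (~ (LeastAt 0 9) ⇒
                ∃ᵃ 1 (v 1 ◃ v 0 ∧ ~ (∃ᵃ 2 (v 1 ◃ v 2 ∧ v 2 ◃ v 0)))))
  wf        : TMSOFin (∀' 0 (~ (v 0 ≐ bot) ⇒
                ∃ᵃ 1 (v 1 ⊑ v 0 ∧ ∀ᵃ 2 (v 2 ⊑ v 0 ⇒ ~ (v 2 ◃ v 1)))))

IsModelMSOFin : Structure → Set
IsModelMSOFin M = ∀ σ → TMSOFin σ → _⊨_ M σ

-- s(x) = y : x ◁ 0* and y is the immediate ◁-successor of x
-- (z, w are bound helper names distinct from x, y)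
SuccF : ℕ → ℕ → ℕ → ℕ → Fm
SuccF x y z w = ∃' z (GreatestAt z w ∧ v x ◃ v z) ∧ v x ◃ v y ∧
                ~ (∃ᵃ z (v x ◃ v z ∧ v z ◃ v y))

-- (φ(0) ∧ ∀x∀y((φ(x) ∧ s(x)=y) → φ(y))) → ∀x φ(x),
-- where φ has x as its only free variable; y = x+1, z = x+2, w = x+3.
-- φ(0) is rendered as ∃x (x is the least atom ∧ φ), and
-- φ(y) as ∃x (x = y ∧ φ).
Induction : Fm → ℕ → Fm
Induction φ x =
  (∃' x (LeastAt x y ∧ φ) ∧
   ∀ᵃ x (∀ᵃ y ((φ ∧ SuccF x y z w) ⇒ ∃' x (v x ≐ v y ∧ φ))))
  ⇒ ∀ᵃ x φ
  where
  y = suc x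
  z = suc y
  w = suc z

{-# OPTIONS --safe #-}
-- If φ failed at some atom, comprehension would give the set of atoms where φ fails, and
-- well-foundedness a ◁-least atom a in it. Since φ(0) holds, a is not the least atom, so by
-- discreteness it has an immediate predecessor b; b satisfies φ by minimality of a, and b lies
-- below the greatest atom, so s(b) = a and the induction step yields φ(a).
-- Satisfaction is the double-negation reading, so the argument runs in the ¬¬ monad.
module Submission where

open import Defs
open import Data.Nat using (ℕ; suc; _≟_)
open import Data.Nat.Properties using (1+n≢n; m≢1+n+m)
open import Data.Product using (_×_; _,_; ∃; ∃-syntax; proj₁; proj₂; curry)
open import Effect.Monad using (RawMonad)
open import Function using (_∘_)
open import Level using (0ℓ)
open import Relation.Nullary using (¬_; yes; no)
open import Relation.Nullary.Decidable using (¬¬-excluded-middle)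
open import Relation.Nullary.Negation using (¬¬-Monad; contradiction)
open import Relation.Binary.PropositionalEquality
  using (_≡_; _≢_; refl; sym; trans; subst; subst₂; ≢-sym)

open RawMonad (¬¬-Monad {a = 0ℓ}) using (_>>=_; pure)

OnlyFree-~ : ∀ {x η} → OnlyFree x η → OnlyFree x (~ η)
OnlyFree-~ only y (f⇒ˡ f) = only y f

OnlyFree⇒¬Free-suc : ∀ {x η} → OnlyFree x η → ¬ Free (suc x) η
OnlyFree⇒¬Free-suc only f = 1+n≢n (only _ f)

module Semantics (M : Structure) where
  open Structure M

  infix  3 _⊩_
  infix  4 _⊑ᶜ_ _◁ᶜ_ _≈ᶜ_
  infixr 2 _∨ᶜ_

  _⟨_≔_⟩ : Env M → ℕ → Carrier → Env M
  _⟨_≔_⟩ = _[_≔_] M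

  _⊩_ : Env M → Fm → Set
  ρ ⊩ φ = ⟦_⟧ M φ ρ

  -- ᶜ marks the classical (double-negated) meanings of the atomic formulas and of ∨.
  Atᶜ : Carrier → Set
  Atᶜ a = ¬ ¬ Atᴹ a

  _⊑ᶜ_ _◁ᶜ_ _≈ᶜ_ : Carrier → Carrier → Set
  a ⊑ᶜ b = ¬ ¬ (a ⊆ᴹ b)
  a ◁ᶜ b = ¬ ¬ (a ◁ᴹ b)
  a ≈ᶜ b = ¬ ¬ (a ≡ b)

  _∨ᶜ_ : Set → Set → Set
  A ∨ᶜ B = ¬ (¬ A × ¬ B)

  IsLeastAtom IsGreatestAtom : Carrier → Set
  IsLeastAtom    l = Atᶜ l × (∀ c → Atᶜ c → c ≈ᶜ l ∨ᶜ l ◁ᶜ c)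
  IsGreatestAtom g = Atᶜ g × (∀ c → Atᶜ c → c ≈ᶜ g ∨ᶜ c ◁ᶜ g)

  IsImmediatePredecessor : Carrier → Carrier → Set
  IsImmediatePredecessor b a = b ◁ᶜ a × ¬ (∃[ c ] Atᶜ c × b ◁ᶜ c × c ◁ᶜ a)

  private
    variable
      x y z w : ℕ
      a g : Carrier
      ρ σ σ′ : Env M

  update-≡ : ∀ ρ x a → (ρ ⟨ x ≔ a ⟩) x ≡ a
  update-≡ ρ x a with x ≟ x
  ... | yes _   = refl
  ... | no  x≢x = contradiction refl x≢x

  update-≢ : ∀ ρ a → y ≢ x → (ρ ⟨ x ≔ a ⟩) y ≡ ρ y
  update-≢ {y} {x} ρ a y≢x with y ≟ x
  ... | yes y≡x = contradiction y≡x y≢x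
  ... | no  _   = refl

  update-cong : ∀ z → (z ≢ y → σ z ≡ σ′ z) → (σ ⟨ y ≔ a ⟩) z ≡ (σ′ ⟨ y ≔ a ⟩) z
  update-cong {y} z agree with z ≟ y
  ... | yes _   = refl
  ... | no  z≢y = agree z≢y

  evalT-coincidence : ∀ t → (∀ {y} → FreeT y t → σ y ≡ σ′ y) → evalT M σ t ≡ evalT M σ′ t
  evalT-coincidence (v x) agree = agree refl
  evalT-coincidence bot   agree = refl

  ⊩-coincidence : ∀ φ → (∀ {y} → Free y φ → σ y ≡ σ′ y) → σ ⊩ φ → σ′ ⊩ φ
  ⊩-coincidence (t ⊑ u) agree = subst₂ _⊑ᶜ_
    (evalT-coincidence t (agree ∘ f⊑ˡ)) (evalT-coincidence u (agree ∘ f⊑ʳ))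
  ⊩-coincidence (t ◃ u) agree = subst₂ _◁ᶜ_
    (evalT-coincidence t (agree ∘ f◃ˡ)) (evalT-coincidence u (agree ∘ f◃ʳ))
  ⊩-coincidence (t ≐ u) agree = subst₂ _≈ᶜ_
    (evalT-coincidence t (agree ∘ f≐ˡ)) (evalT-coincidence u (agree ∘ f≐ʳ))
  ⊩-coincidence (At t)  agree = subst Atᶜ (evalT-coincidence t (agree ∘ fAt))
  ⊩-coincidence ff      agree ()
  ⊩-coincidence (φ ⇒ ψ) agree φ⇒ψ =
    ⊩-coincidence ψ (agree ∘ f⇒ʳ) ∘ φ⇒ψ ∘ ⊩-coincidence φ (sym ∘ agree ∘ f⇒ˡ)
  ⊩-coincidence (φ ∧ ψ) agree (φ-holds , ψ-holds) =
    ⊩-coincidence φ (agree ∘ f∧ˡ) φ-holds , ⊩-coincidence ψ (agree ∘ f∧ʳ) ψ-holds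
  ⊩-coincidence (∀' y φ) agree ∀φ a =
    ⊩-coincidence φ (λ {z} f → update-cong z (λ z≢y → agree (f∀ z≢y f))) (∀φ a)

  ⊩-stable : ∀ φ → ¬ ¬ (ρ ⊩ φ) → ρ ⊩ φ
  ⊩-stable (t ⊑ u) ¬¬φ ¬φ = ¬¬φ (λ φ-holds → φ-holds ¬φ)
  ⊩-stable (t ◃ u) ¬¬φ ¬φ = ¬¬φ (λ φ-holds → φ-holds ¬φ)
  ⊩-stable (t ≐ u) ¬¬φ ¬φ = ¬¬φ (λ φ-holds → φ-holds ¬φ)
  ⊩-stable (At t)  ¬¬φ ¬φ = ¬¬φ (λ φ-holds → φ-holds ¬φ)
  ⊩-stable ff      ¬¬φ    = ¬¬φ (λ ())
  ⊩-stable (φ ⇒ ψ) ¬¬φ⇒ψ φ-holds = ⊩-stable ψ (λ ¬ψ → ¬¬φ⇒ψ (λ φ⇒ψ → ¬ψ (φ⇒ψ φ-holds)))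
  ⊩-stable (φ ∧ ψ) ¬¬φ∧ψ = ⊩-stable φ (λ ¬φ → ¬¬φ∧ψ (¬φ ∘ proj₁))
                        , ⊩-stable ψ (λ ¬ψ → ¬¬φ∧ψ (¬ψ ∘ proj₂))
  ⊩-stable (∀' y φ) ¬¬∀φ a = ⊩-stable φ (λ ¬φa → ¬¬∀φ (λ ∀φ → ¬φa (∀φ a)))

  ⊩-onlyFree : ∀ {φ} → OnlyFree x φ → σ x ≡ σ′ x → σ ⊩ φ → σ′ ⊩ φ
  ⊩-onlyFree {σ = σ} {σ′} {φ} only σx≡σ′x =
    ⊩-coincidence φ (λ {y} f → subst (λ y → σ y ≡ σ′ y) (sym (only y f)) σx≡σ′x)

  ⊩LeastAt⇒IsLeastAtom : x ≢ y → ρ ⊩ LeastAt x y → IsLeastAtom (ρ x)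
  ⊩LeastAt⇒IsLeastAtom {x} {y} {ρ} x≢y (at , least) = at , λ c at-c →
    subst₂ (λ c l → c ≈ᶜ l ∨ᶜ l ◁ᶜ c) (update-≡ ρ y c) (update-≢ ρ c x≢y)
      (least c (subst Atᶜ (sym (update-≡ ρ y c)) at-c))

  IsGreatestAtom⇒⊩GreatestAt : z ≢ w → IsGreatestAtom (ρ z) → ρ ⊩ GreatestAt z w
  IsGreatestAtom⇒⊩GreatestAt {z} {w} {ρ} z≢w (at , greatest) = at , λ c at-c →
    subst₂ (λ c g → c ≈ᶜ g ∨ᶜ c ◁ᶜ g) (sym (update-≡ ρ w c)) (sym (update-≢ ρ c z≢w))
      (greatest c (subst Atᶜ (update-≡ ρ w c) at-c))

  ⊩SuccF : x ≢ z → y ≢ z → z ≢ w → IsGreatestAtom g → ρ x ◁ᶜ g →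
           IsImmediatePredecessor (ρ x) (ρ y) → ρ ⊩ SuccF x y z w
  ⊩SuccF {x} {z} {y} {w} {g} {ρ} x≢z y≢z z≢w g-greatest x◁g (x◁y , nothing-between) =
    below-greatest , x◁y , λ ¬∀¬between → ¬∀¬between λ c (at-c , x◁c , c◁y) →
      nothing-between (c , subst Atᶜ (update-≡ ρ z c) at-c
                         , subst₂ _◁ᶜ_ (update-≢ ρ c x≢z) (update-≡ ρ z c) x◁c
                         , subst₂ _◁ᶜ_ (update-≡ ρ z c) (update-≢ ρ c y≢z) c◁y)
    where
    below-greatest : ρ ⊩ ∃' z (GreatestAt z w ∧ v x ◃ v z)
    below-greatest ¬∃ = ¬∃ g
      ( IsGreatestAtom⇒⊩GreatestAt z≢w (subst IsGreatestAtom (sym (update-≡ ρ z g)) g-greatest)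
      , subst₂ _◁ᶜ_ (sym (update-≢ ρ g x≢z)) (sym (update-≡ ρ z g)) x◁g )

module MSOFinModel (M : Structure) (M⊨T : IsModelMSOFin M) where
  open Structure M
  open Semantics M

  private
    variable
      a b c g S : Carrier

  -- The axioms are sentences, so any environment will do; we use the constant one at an element at hand.
  ⊑ᶜ-antisym : a ⊑ᶜ b → b ⊑ᶜ a → a ≈ᶜ b
  ⊑ᶜ-antisym {a} {b} a⊑b b⊑a = M⊨T _ (base ⊆-antisym) (λ _ → a) a b (a⊑b , b⊑a)

  ⊥ᴹ-least : ∀ a → ⊥ᴹ ⊑ᶜ a
  ⊥ᴹ-least a = M⊨T _ (base ⊥-least) (λ _ → a) a

  atom≉⊥ : Atᶜ a → ¬ a ≈ᶜ ⊥ᴹ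
  atom≉⊥ {a} at-a = proj₁ (proj₁ (M⊨T _ (base At-atom) (λ _ → a) a) at-a)

  atom-below⇒≉⊥ : Atᶜ a → a ⊑ᶜ S → ¬ S ≈ᶜ ⊥ᴹ
  atom-below⇒≉⊥ {a} at-a a⊑S S≈⊥ = S≈⊥ λ { refl → atom≉⊥ at-a (⊑ᶜ-antisym a⊑S (⊥ᴹ-least a)) }

  ◁ᶜ-irrefl : Atᶜ a → ¬ a ◁ᶜ a
  ◁ᶜ-irrefl {a} = M⊨T _ (base ◃-irrefl) (λ _ → a) a

  ◁ᶜ-trans : Atᶜ a → Atᶜ b → Atᶜ c → a ◁ᶜ b → b ◁ᶜ c → a ◁ᶜ c
  ◁ᶜ-trans {a} {b} {c} at-a at-b at-c a◁b b◁c =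
    M⊨T _ (base ◃-trans) (λ _ → a) a at-a b at-b c at-c (a◁b , b◁c)

  IsLeastAtom-unique : IsLeastAtom a → IsLeastAtom b → a ≈ᶜ b
  IsLeastAtom-unique (at-a , a-least) (at-b , b-least) a≢b =
    a-least _ at-b ((λ b≈a → b≈a (a≢b ∘ sym)) , λ a◁b →
      b-least _ at-a ((λ a≈b → a≈b a≢b) , λ b◁a → ◁ᶜ-irrefl at-a (◁ᶜ-trans at-a at-b at-a a◁b b◁a)))

  ◁ᶜ-greatest : IsGreatestAtom g → Atᶜ b → Atᶜ a → b ◁ᶜ a → b ◁ᶜ g
  ◁ᶜ-greatest (at-g , greatest) at-b at-a b◁a b⋪g = greatest _ at-a
    ( (λ a≈g → a≈g λ { refl → b◁a b⋪g })
    , (λ a◁g → ◁ᶜ-trans at-b at-a at-g b◁a a◁g b⋪g) )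

  greatest-atom : Atᶜ a → ¬ ¬ ∃ IsGreatestAtom
  greatest-atom {a} at-a = M⊨T _ great-ex (λ _ → a) a at-a ∘ curry

  immediate-predecessor : Atᶜ a → ¬ IsLeastAtom a →
                          ¬ ¬ (∃[ b ] Atᶜ b × IsImmediatePredecessor b a)
  immediate-predecessor {a} at-a not-least = do
    (b , at-b , b◁a , ¬¬nothing-between) ← M⊨T _ pred-ex (λ _ → a) a at-a not-least ∘ curry
    pure (b , at-b , b◁a , λ (c , between) → ¬¬nothing-between (λ none → none c between))

  ◁ᶜ-least-atom-below : ¬ S ≈ᶜ ⊥ᴹ →
    ¬ ¬ (∃[ a ] Atᶜ a × a ⊑ᶜ S × (∀ c → Atᶜ c → c ⊑ᶜ S → ¬ c ◁ᶜ a))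
  ◁ᶜ-least-atom-below {S} S≉⊥ = M⊨T _ wf (λ _ → S) S S≉⊥ ∘ curry

  comprehension : ∀ η x → OnlyFree x η → (ρ : Env M) →
    ¬ ¬ (∃[ S ] (∀ c → Atᶜ c → (c ⊑ᶜ S → ρ ⟨ x ≔ c ⟩ ⊩ η) × (ρ ⟨ x ≔ c ⟩ ⊩ η → c ⊑ᶜ S)))
  comprehension η x only ρ = do
    (S , S-spec) ← M⊨T _ (base (compr η x X x≢X (OnlyFree⇒¬Free-suc only))) ρ ∘ curry
    pure (S , λ c at-c →
      let τ = (ρ ⟨ X ≔ S ⟩) ⟨ x ≔ c ⟩
          τx≡c : τ x ≡ c
          τx≡c = update-≡ _ x c
          τX≡S : τ X ≡ S
          τX≡S = trans (update-≢ _ c (≢-sym x≢X)) (update-≡ ρ X S)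
          τx≡ρx : τ x ≡ (ρ ⟨ x ≔ c ⟩) x
          τx≡ρx = trans τx≡c (sym (update-≡ ρ x c))
          (⊑⇒η , η⇒⊑) = S-spec c (subst Atᶜ (sym τx≡c) at-c)
      in (λ c⊑S → ⊩-onlyFree only τx≡ρx (⊑⇒η (subst₂ _⊑ᶜ_ (sym τx≡c) (sym τX≡S) c⊑S)))
       , (λ ηc → subst₂ _⊑ᶜ_ τx≡c τX≡S (η⇒⊑ (⊩-onlyFree only (sym τx≡ρx) ηc))))
    where
    X = suc x
    x≢X : x ≢ X
    x≢X = ≢-sym 1+n≢n

  definable-◁ᶜ-induction : ∀ η x → OnlyFree x η → (ρ : Env M) →
    (∀ a → Atᶜ a → (∀ c → Atᶜ c → c ◁ᶜ a → ρ ⟨ x ≔ c ⟩ ⊩ η) → ρ ⟨ x ≔ a ⟩ ⊩ η) →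
    ∀ a → Atᶜ a → ρ ⟨ x ≔ a ⟩ ⊩ η
  definable-◁ᶜ-induction η x only ρ progressive a at-a = ⊩-stable η do
    no ¬ηa ← ¬¬-excluded-middle
      where yes ηa → pure ηa
    (S , S-spec) ← comprehension (~ η) x (OnlyFree-~ only) ρ
    let ¬η⇒∈S c at-c = proj₂ (S-spec c at-c)
    (m , at-m , m∈S , m-least) ← ◁ᶜ-least-atom-below (atom-below⇒≉⊥ at-a (¬η⇒∈S a at-a ¬ηa))
    let ηm = progressive m at-m λ c at-c c◁m →
               ⊩-stable η λ ¬ηc → m-least c at-c (¬η⇒∈S c at-c ¬ηc) c◁m
    contradiction ηm (proj₁ (S-spec m at-m) m∈S)

module InductionSchema (M : Structure) (M⊨T : IsModelMSOFin M)
                       (φ : Fm) (x : ℕ) (only : OnlyFree x φ) (ρ : Env M) where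
  open Structure M
  open Semantics M
  open MSOFinModel M M⊨T

  y z w : ℕ
  y = suc x
  z = suc y
  w = suc z

  x≢y : x ≢ y
  x≢y = ≢-sym 1+n≢n

  x≢z : x ≢ z
  x≢z = m≢1+n+m x {1}

  y≢z : y ≢ z
  y≢z = ≢-sym 1+n≢n

  z≢w : z ≢ w
  z≢w = ≢-sym 1+n≢n

  Φ : Carrier → Set
  Φ c = ρ ⟨ x ≔ c ⟩ ⊩ φ

  Φ-resp-≈ᶜ : ∀ {a b} → a ≈ᶜ b → Φ a → Φ b
  Φ-resp-≈ᶜ a≈b Φa = ⊩-stable φ λ ¬Φb → a≈b λ { refl → ¬Φb Φa }

  base-case : ρ ⊩ ∃' x (LeastAt x y ∧ φ) → ∀ {a} → IsLeastAtom a → Φ a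
  base-case φ-least a-least = ⊩-stable φ do
    (l , l-least , Φl) ← φ-least ∘ curry
    let l≈a = IsLeastAtom-unique
                (subst IsLeastAtom (update-≡ ρ x l) (⊩LeastAt⇒IsLeastAtom x≢y l-least)) a-least
    pure (Φ-resp-≈ᶜ l≈a Φl)

  step-case : ρ ⊩ ∀ᵃ x (∀ᵃ y ((φ ∧ SuccF x y z w) ⇒ ∃' x (v x ≐ v y ∧ φ))) →
              ∀ {a b g} → Atᶜ b → Atᶜ a → IsGreatestAtom g → b ◁ᶜ g →
              IsImmediatePredecessor b a → Φ b → Φ a
  step-case φ-step {a} {b} at-b at-a g-greatest b◁g b-pred Φb = ⊩-stable φ do
    (d , d≈a , φd) ← φ-step b (subst Atᶜ (sym (update-≡ ρ x b)) at-b) a (subst Atᶜ (sym σy≡a) at-a)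
                       (φσ , succ) ∘ curry
    let Φd = ⊩-onlyFree only (sym (update-≡ ρ x _)) φd
    pure (subst Φ (trans (update-≢ σ d (≢-sym x≢y)) σy≡a) (Φ-resp-≈ᶜ d≈a Φd))
    where
    σ = (ρ ⟨ x ≔ b ⟩) ⟨ y ≔ a ⟩
    σx≡b : σ x ≡ b
    σx≡b = trans (update-≢ _ a x≢y) (update-≡ ρ x b)
    σy≡a : σ y ≡ a
    σy≡a = update-≡ _ y a
    φσ : σ ⊩ φ
    φσ = ⊩-onlyFree only (trans (update-≡ ρ x b) (sym σx≡b)) Φb
    succ : σ ⊩ SuccF x y z w
    succ = ⊩SuccF x≢z y≢z z≢w g-greatest (subst (_◁ᶜ _) (sym σx≡b) b◁g)
             (subst₂ IsImmediatePredecessor (sym σx≡b) (sym σy≡a) b-pred)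

  Φ-progressive : ρ ⊩ ∃' x (LeastAt x y ∧ φ) →
                  ρ ⊩ ∀ᵃ x (∀ᵃ y ((φ ∧ SuccF x y z w) ⇒ ∃' x (v x ≐ v y ∧ φ))) →
                  ∀ a → Atᶜ a → (∀ c → Atᶜ c → c ◁ᶜ a → Φ c) → Φ a
  Φ-progressive φ-least φ-step a at-a below = ⊩-stable φ do
    no not-least ← ¬¬-excluded-middle
      where yes a-least → pure (base-case φ-least a-least)
    (b , at-b , b-pred@(b◁a , _)) ← immediate-predecessor at-a not-least
    (g , g-greatest) ← greatest-atom at-a
    let b◁g = ◁ᶜ-greatest g-greatest at-b at-a b◁a
    pure (step-case φ-step at-b at-a g-greatest b◁g b-pred (below b at-b b◁a))

lemma3p7 : (M : Structure) → IsModelMSOFin M →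
           (φ : Fm) (x : ℕ) → OnlyFree x φ →
           _⊨_ M (Induction φ x)
lemma3p7 M M⊨T φ x only ρ (φ-least , φ-step) a at-a =
  definable-◁ᶜ-induction φ x only ρ (Φ-progressive φ-least φ-step) a
    (subst Atᶜ (update-≡ ρ x a) at-a)
  where
  open Semantics M
  open MSOFinModel M M⊨T
  open InductionSchema M M⊨T φ x only ρ
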